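{- Let $G$ be a connected graph, let $\mathcal Y$ be a collection of principal vertex sets of $G$, and let $G_{\mathcal Y}$ be obtained from $G$ by turning each $G[X]$ with $X\in\mathcal Y$ into a clique. Then the finite-order separations of $G$ are precisely the finite-order separations of $G_{\mathcal Y}$. In particular, $G$ and $G_{\mathcal Y}$ have the same $\aleph_0$-tangles.
   Context: A separation of a graph $G=(V,E)$ is $\{A,B\}$ with $A\cup B=V$ and no edge between $A\setminus B$ and $B\setminus A$; its order is $|A\cap B|$. A finite vertex set $X$ of $G$ is principal if for every finite $Y\subseteq V$, $X$ meets at most one component of $G-Y$. An $\aleph_0$-tangle of $G$ is a consistent orientation of the set of finite-order separations of $G$ (choosing one of $(A,B),(B,A)$ for each; consistent means no distinct $r,s$ with orientations $\vec r<\vec s$, in the order $(A,B)\le(C,D)$ iff $A\subseteq C,B\supseteq D$, such that the inverse $\overleftarrow r$ and $\vec s$ both are chosen) containing no finite set $\sigma$ of oriented separations with $\vec r\le\overleftarrow s$ for all distinct members (a star) whose interior $\bigcap\{B:(A,B)\in\sigma\}$ is finite. -}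

module Defs where

open import Data.List using (List; []; _∷_)
open import Data.List.Membership.Propositional using (_∈_)
open import Data.Product using (Σ; ∃; _×_; _,_)
open import Data.Sum using (_⊎_)
open import Data.Empty using (⊥)
open import Data.Unit using (⊤)
open import Relation.Nullary using (¬_)
open import Relation.Binary.PropositionalEquality using (_≡_; _≢_)

record Graph : Set₁ where
  field
    V     : Set
    E     : V → V → Set
    sym   : ∀ {u v} → E u v → E v u
    irrefl : ∀ {v} → ¬ E v v
open Graph public

VSet : Set → Set₁
VSet V = V → Set

Finite : {V : Set} → VSet V → Set
Finite {V} P = Σ (List V) λ L → ∀ v → P v → v ∈ L

-- Connectivity in G - Y (Y a finite vertex set given as a list):
-- u and v lie in the same component of G - Y.
data ConnAvoid (G : Graph) (Y : List (V G)) : V G → V G → Set where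
  here : ∀ {u} → ¬ (u ∈ Y) → ConnAvoid G Y u u
  step : ∀ {u w v} → ¬ (u ∈ Y) → E G u w → ConnAvoid G Y w v → ConnAvoid G Y u v

Connected : Graph → Set
Connected G = ∀ u v → ConnAvoid G [] u v

-- A finite vertex set X is principal if for every finite Y, X meets at most one
-- component of G - Y.
Principal : (G : Graph) → List (V G) → Set
Principal G X = ∀ (Y : List (V G)) x x' → x ∈ X → x' ∈ X →
  ¬ (x ∈ Y) → ¬ (x' ∈ Y) → ConnAvoid G Y x x'

cliqueEdge : (G : Graph) → (List (V G) → Set) → V G → V G → Set
cliqueEdge G 𝒴 u v = E G u v ⊎ (u ≢ v × Σ (List (V G)) λ X → 𝒴 X × u ∈ X × v ∈ X)

Gclique : (G : Graph) → (List (V G) → Set) → Graph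
Gclique G 𝒴 = record
  { V = V G
  ; E = cliqueEdge G 𝒴
  ; sym = λ { (Data.Sum.inj₁ e) → Data.Sum.inj₁ (sym G e)
            ; (Data.Sum.inj₂ (ne , X , y , u∈ , v∈)) →
                Data.Sum.inj₂ ((λ eq → ne (Relation.Binary.PropositionalEquality.sym eq)) , X , y , v∈ , u∈) }
  ; irrefl = λ { (Data.Sum.inj₁ e) → irrefl G e
               ; (Data.Sum.inj₂ (ne , _)) → ne Relation.Binary.PropositionalEquality.refl }
  }

IsSeparation : (G : Graph) → VSet (V G) → VSet (V G) → Set
IsSeparation G A B =
  (∀ v → A v ⊎ B v) ×
  (∀ u v → A u → ¬ B u → B v → ¬ A v → ¬ E G u v)

FiniteOrder : {V : Set} → VSet V → VSet V → Set
FiniteOrder A B = Finite (λ v → A v × B v)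

IsFinSep : (G : Graph) → VSet (V G) → VSet (V G) → Set
IsFinSep G A B = IsSeparation G A B × FiniteOrder A B

_⊆_ : {V : Set} → VSet V → VSet V → Set
A ⊆ B = ∀ v → A v → B v

_≐_ : {V : Set} → VSet V → VSet V → Set
A ≐ B = A ⊆ B × B ⊆ A

OSep : Set → Set₁
OSep V = VSet V × VSet V

_≤ₛ_ : {V : Set} → OSep V → OSep V → Set
(A , B) ≤ₛ (C , D) = A ⊆ C × D ⊆ B

inv : {V : Set} → OSep V → OSep V
inv (A , B) = (B , A)

_≐ₒ_ : {V : Set} → OSep V → OSep V → Set
(A , B) ≐ₒ (C , D) = A ≐ C × B ≐ D

SameSep : {V : Set} → OSep V → OSep V → Set
SameSep r s = r ≐ₒ s ⊎ r ≐ₒ inv s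

interior : {V : Set} → List (OSep V) → VSet V
interior [] v = ⊤
interior ((A , B) ∷ σ) v = B v × interior σ v

IsAleph0Tangle : (G : Graph) → (OSep (V G) → Set) → Set₁
IsAleph0Tangle G τ =
  (∀ A B → τ (A , B) → IsFinSep G A B) ×
  (∀ A B → IsFinSep G A B → τ (A , B) ⊎ τ (B , A)) ×
  (∀ A B → τ (A , B) → τ (B , A) → A ≐ B) ×
  (∀ r s → IsFinSep G (Data.Product.proj₁ r) (Data.Product.proj₂ r) →
           IsFinSep G (Data.Product.proj₁ s) (Data.Product.proj₂ s) →
           ¬ SameSep r s → r ≤ₛ s → τ (inv r) → τ s → ⊥) ×
  -- no star σ ⊆ τ with finite interior
  (∀ (σ : List (OSep (V G))) →
     (∀ r → r ∈ σ → τ r) →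
     (∀ r s → r ∈ σ → s ∈ σ → ¬ (r ≐ₒ s) → r ≤ₛ inv s) →
     Finite (interior σ) → ⊥)

-- Every edge of G is an edge of G_𝒴, so each separation of G_𝒴 is one of G.
-- Conversely let {A,B} be a finite-order separation of G and u ∈ A∖B,
-- v ∈ B∖A lie in a common principal set X.  Put Y := A ∩ B (a finite list).
-- Principality joins u and v by a path in G - Y, but a path avoiding A ∩ B
-- that starts in A∖B can never reach B∖A without using an edge between A∖B
-- and B∖A.  So no new clique edge crosses {A,B}.
-- Listing A ∩ B requires deciding membership in A ∩ B for the finitely many
-- vertices of a covering list; since the goal is a contradiction, this is
-- done inside the double-negation monad.
-- Finally an ℵ₀-tangle refers to its graph only through the predicate "is a
-- finite-order separation", so graphs on the same vertex set with the same
-- finite-order separations have the same ℵ₀-tangles.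
module Submission where

open import Defs
open import Data.List using (List; []; _∷_)
open import Data.List.Relation.Unary.Any using (here; there)
open import Data.List.Membership.Propositional using (_∈_)
open import Data.Product using (_×_; Σ; _,_; proj₁; proj₂)
open import Data.Sum using (inj₁; inj₂)
open import Data.Empty using (⊥; ⊥-elim)
open import Relation.Nullary using (¬_; yes; no)
open import Relation.Nullary.Decidable using (¬¬-excluded-middle)
open import Relation.Binary.PropositionalEquality using (refl)
open import Function.Bundles using (_⇔_; mk⇔; Equivalence)
open import Function.Properties.Equivalence using () renaming (sym to ⇔-sym)

-- The part of a list satisfying an arbitrary predicate, as a list.  Without
-- decidability of P this exists only up to double negation.
listFilter : {W : Set} (P : W → Set) (L : List W) →
  ¬ ¬ (Σ (List W) λ Y → (∀ y → y ∈ Y → P y) × (∀ v → P v → v ∈ L → v ∈ Y))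
listFilter P [] k = k ([] , (λ _ ()) , λ _ _ ())
listFilter P (l ∷ L) k = listFilter P L λ { (Y , Y⊆P , P∩L⊆Y) →
  ¬¬-excluded-middle λ
    { (yes pl) → k (l ∷ Y , (λ { _ (here refl) → pl ; y (there y∈) → Y⊆P y y∈ })
                          , λ { _ _ (here refl) → here refl
                              ; v pv (there v∈) → there (P∩L⊆Y v pv v∈) })
    ; (no ¬pl) → k (Y , Y⊆P , λ { _ pl (here refl) → ⊥-elim (¬pl pl)
                                 ; v pv (there v∈) → P∩L⊆Y v pv v∈ }) } }

start∉ : ∀ {G Y u v} → ConnAvoid G Y u v → ¬ (u ∈ Y)
start∉ (here u∉) = u∉
start∉ (step u∉ _ _) = u∉

-- A path avoiding a list Y ⊇ A ∩ B cannot lead from A∖B to B∖A: it stays in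
-- A∖B, since entering B would mean entering A ∩ B or crossing the separation.
separator-blocks-paths : (G : Graph) {A B : VSet (V G)} → IsSeparation G A B →
  (Y : List (V G)) → (∀ v → A v → B v → v ∈ Y) →
  ∀ {u v} → ConnAvoid G Y u v → A u → ¬ B u → B v → ¬ A v → ⊥
separator-blocks-paths G sep Y A∩B⊆Y (here _) _ ¬bu bv _ = ¬bu bv
separator-blocks-paths G {A} {B} sep@(cover , noCross) Y A∩B⊆Y
  {u} (step {w = w} _ uw path) au ¬bu bv ¬av
  with cover w
... | inj₁ aw = separator-blocks-paths G sep Y A∩B⊆Y path aw w∉B bv ¬av
  where
  w∉B : ¬ B w
  w∉B bw = start∉ path (A∩B⊆Y w aw bw)
... | inj₂ bw = noCross u w au ¬bu bw w∉A uw
  where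
  w∉A : ¬ A w
  w∉A aw = start∉ path (A∩B⊆Y w aw bw)

principal-not-split : (G : Graph) {A B : VSet (V G)} → IsFinSep G A B →
  (X : List (V G)) → Principal G X →
  ∀ {u v} → u ∈ X → v ∈ X → A u → ¬ B u → B v → ¬ A v → ⊥
principal-not-split G {A} {B} (sep , (L , A∩B⊆L)) X principal
  u∈X v∈X au ¬bu bv ¬av =
  listFilter (λ w → A w × B w) L λ { (Y , Y⊆A∩B , A∩B∩L⊆Y) →
    separator-blocks-paths G sep Y
      (λ w aw bw → A∩B∩L⊆Y w (aw , bw) (A∩B⊆L w (aw , bw)))
      (principal Y _ _ u∈X v∈X (λ u∈Y → ¬bu (proj₂ (Y⊆A∩B _ u∈Y)))
                               (λ v∈Y → ¬av (proj₁ (Y⊆A∩B _ v∈Y))))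
      au ¬bu bv ¬av }

onVertices : (G : Graph) (F : V G → V G → Set) →
  (∀ {u v} → F u v → F v u) → (∀ {v} → ¬ F v v) → Graph
onVertices G F F-sym F-irrefl =
  record { V = V G ; E = F ; sym = F-sym ; irrefl = F-irrefl }

separation-of-subgraph : (G : Graph) (F : V G → V G → Set)
  (F-sym : ∀ {u v} → F u v → F v u) (F-irrefl : ∀ {v} → ¬ F v v) →
  (∀ {u v} → E G u v → F u v) → ∀ {A B} →
  IsFinSep (onVertices G F F-sym F-irrefl) A B → IsFinSep G A B
separation-of-subgraph G F _ _ G⊆F ((cover , noCross) , finite) =
  (cover , λ u v au ¬bu bv ¬av uv → noCross u v au ¬bu bv ¬av (G⊆F uv)) , finite

clique-separations : (G : Graph) (𝒴 : List (V G) → Set) →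
  (∀ X → 𝒴 X → Principal G X) →
  ∀ A B → IsFinSep G A B ⇔ IsFinSep (Gclique G 𝒴) A B
clique-separations G 𝒴 principal A B =
  mk⇔ toClique (separation-of-subgraph G (E H) (sym H) (irrefl H) inj₁)
  where
  H : Graph
  H = Gclique G 𝒴
  toClique : IsFinSep G A B → IsFinSep H A B
  toClique finSep@((cover , noCross) , finite) = (cover , noCross′) , finite
    where
    noCross′ : ∀ u v → A u → ¬ B u → B v → ¬ A v → ¬ cliqueEdge G 𝒴 u v
    noCross′ u v au ¬bu bv ¬av (inj₁ uv) = noCross u v au ¬bu bv ¬av uv
    noCross′ u v au ¬bu bv ¬av (inj₂ (_ , X , X∈𝒴 , u∈X , v∈X)) =
      principal-not-split G finSep X (principal X X∈𝒴) u∈X v∈X au ¬bu bv ¬av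

tangle-transfer : (G : Graph) (F : V G → V G → Set)
  (F-sym : ∀ {u v} → F u v → F v u) (F-irrefl : ∀ {v} → ¬ F v v) →
  (let H = onVertices G F F-sym F-irrefl) →
  (∀ A B → IsFinSep G A B ⇔ IsFinSep H A B) →
  ∀ τ → IsAleph0Tangle G τ → IsAleph0Tangle H τ
tangle-transfer G F F-sym F-irrefl sameSeps τ
  (onlySeps , orients , antisymmetric , consistent , noSmallStar) =
    (λ A B τAB → to (sameSeps A B) (onlySeps A B τAB))
  , (λ A B sepH → orients A B (from (sameSeps A B) sepH))
  , antisymmetric
  , (λ r s sepR sepS → consistent r s (from (sameSeps _ _) sepR)
                                      (from (sameSeps _ _) sepS))
  , noSmallStar
  where open Equivalence

lemma5p4 : (G : Graph) → Connected G → (𝒴 : List (V G) → Set) →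
    (∀ X → 𝒴 X → Principal G X) →
    (∀ (A B : VSet (V G)) → IsFinSep G A B ⇔ IsFinSep (Gclique G 𝒴) A B) ×
    (∀ (τ : OSep (V G) → Set) → IsAleph0Tangle G τ ⇔ IsAleph0Tangle (Gclique G 𝒴) τ)
lemma5p4 G _ 𝒴 principal = sameSeps , λ τ →
  mk⇔ (tangle-transfer G (E H) (sym H) (irrefl H) sameSeps τ)
      (tangle-transfer H (E G) (sym G) (irrefl G) (λ A B → ⇔-sym (sameSeps A B)) τ)
  where
  H : Graph
  H = Gclique G 𝒴
  sameSeps : ∀ A B → IsFinSep G A B ⇔ IsFinSep H A B
  sameSeps = clique-separations G 𝒴 principal
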